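{- Type checking in the theory Glob is decidable: for every raw context $\Gamma$ the type $\Gamma\vdash$ is decidable; for all raw contexts $\Delta,\Gamma$ and raw substitution $\gamma$ the type $\Delta\vdash\gamma:\Gamma$ is decidable; for every raw context $\Gamma$ and raw type $A$ the type $\Gamma\vdash A$ is decidable; and for every raw context $\Gamma$, raw type $A$ and raw term $t$ the type $\Gamma\vdash t:A$ is decidable. Here a type $X$ is decidable if one can construct an element of $X+\neg X$.
   Context: Meta-theory: Martin-Löf type theory without axiom K. Raw syntax of Glob: raw types $*$ and $\Rightarrow(A,t,u)$; raw terms $\mathrm{Var}\,x$, $x\in\mathbb{N}$; raw contexts are finite lists of pairs $(x,A)$; raw substitutions finite lists of pairs $(x,t)$; $\mathrm{nil}$ empty list, $L::p$ appends $p$. Action of substitutions: $*[\gamma]=*$, $\Rightarrow(A,t,u)[\gamma]=\Rightarrow(A[\gamma],t[\gamma],u[\gamma])$, $\mathrm{Var}\,x[\mathrm{nil}]=\mathrm{Var}\,x$, $\mathrm{Var}\,x[\gamma::(v,t)]=t$ if $x=v$, else $\mathrm{Var}\,x[\gamma]$. Judgements $\Gamma\vdash$, $\Gamma\vdash A$, $\Gamma\vdash t:A$, $\Delta\vdash\gamma:\Gamma$ are inductive families of types (inhabitants are derivations) generated by: (ec) $\mathrm{nil}\vdash$; (cc) from $\Gamma\vdash$, $\Gamma\vdash A$, $x=\mathrm{length}(\Gamma)$ derive $\Gamma::(x,A)\vdash$; (ob) from $\Gamma\vdash$ derive $\Gamma\vdash *$; (ar) from $\Gamma\vdash t:A$,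 $\Gamma\vdash u:A$ derive $\Gamma\vdash\Rightarrow(A,t,u)$; (var) from $\Gamma\vdash$ and a proof that $(x,A)$ is an element of $\Gamma$ derive $\Gamma\vdash\mathrm{Var}\,x:A$; (es) from $\Delta\vdash$ derive $\Delta\vdash\mathrm{nil}:\mathrm{nil}$; (sc) from $\Delta\vdash\gamma:\Gamma$, $\Gamma::(x,A)\vdash$, $\Delta\vdash t:A[\gamma]$, $x=y$ derive $\Delta\vdash\gamma::(y,t):\Gamma::(x,A)$. -}

module Defs where

open import Data.Nat using (ℕ; zero; suc; _≟_)
open import Data.Product using (_×_; _,_)
open import Relation.Binary.PropositionalEquality using (_≡_)
open import Relation.Nullary using (yes; no)

mutual
  data Ty : Set where
    ⋆ : Ty
    ⇒ : Ty → Tm → Tm → Ty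

  data Tm : Set where
    Var : ℕ → Tm

infixl 5 _::_
data SnocList (X : Set) : Set where
  nil  : SnocList X
  _::_ : SnocList X → X → SnocList X

length : {X : Set} → SnocList X → ℕ
length nil = zero
length (L :: _) = suc (length L)

data _∈_ {X : Set} (p : X) : SnocList X → Set where
  here  : ∀ {L} → p ∈ (L :: p)
  there : ∀ {L q} → p ∈ L → p ∈ (L :: q)

Ctx : Set
Ctx = SnocList (ℕ × Ty)

Sub : Set
Sub = SnocList (ℕ × Tm)

_[_]tm : Tm → Sub → Tm
Var x [ nil ]tm = Var x
Var x [ γ :: (v , t) ]tm with x ≟ v
... | yes _ = t
... | no  _ = Var x [ γ ]tm

_[_]ty : Ty → Sub → Ty
⋆ [ γ ]ty = ⋆
⇒ A t u [ γ ]ty = ⇒ (A [ γ ]ty) (t [ γ ]tm) (u [ γ ]tm)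

data _⊢ : Ctx → Set
data _⊢ty_ : Ctx → Ty → Set
data _⊢_∶_ : Ctx → Tm → Ty → Set
data _⊢s_∶_ : Ctx → Sub → Ctx → Set

data _⊢ where
  ec : nil ⊢
  cc : ∀ {Γ A x} → Γ ⊢ → Γ ⊢ty A → x ≡ length Γ → (Γ :: (x , A)) ⊢

data _⊢ty_ where
  ob : ∀ {Γ} → Γ ⊢ → Γ ⊢ty ⋆
  ar : ∀ {Γ A t u} → Γ ⊢ t ∶ A → Γ ⊢ u ∶ A → Γ ⊢ty ⇒ A t u

data _⊢_∶_ where
  var : ∀ {Γ x A} → Γ ⊢ → (x , A) ∈ Γ → Γ ⊢ Var x ∶ A

data _⊢s_∶_ where
  es : ∀ {Δ} → Δ ⊢ → Δ ⊢s nil ∶ nil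
  sc : ∀ {Δ Γ γ x y A t} → Δ ⊢s γ ∶ Γ → (Γ :: (x , A)) ⊢ → Δ ⊢ t ∶ (A [ γ ]ty)
     → x ≡ y → Δ ⊢s (γ :: (y , t)) ∶ (Γ :: (x , A))

-- Every rule of Glob is syntax-directed: the head constructor of the raw
-- context, type, term or substitution determines the only rule that can
-- conclude the judgement, and that rule applies exactly when its premises
-- hold. Each judgement is therefore equivalent to a finite conjunction of
-- smaller judgements, equalities of natural numbers, and membership in a
-- list of pairs with decidable equality. The recursion is well founded:
-- Γ ⊢ty ⋆ and Γ ⊢ Var x ∶ A fall back to Γ ⊢ on the same Γ, but Γ ⊢ only
-- recurses into a strictly shorter context.
module Submission where

open import Defs
open import Data.Nat using (_≟_)
open import Data.Product using (_×_; _,_)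
open import Data.Product.Properties using (≡-dec)
open import Data.Sum using (_⊎_; inj₁; inj₂; [_,_])
open import Function.Bundles using (_⇔_; mk⇔)
open import Relation.Binary.Definitions using (DecidableEquality)
open import Relation.Binary.PropositionalEquality using (_≡_; refl)
open import Relation.Nullary using (¬_; Dec; yes; no)
open import Relation.Nullary.Decidable using (map; map′; toSum; _×-dec_; _⊎-dec_)

_≟tm_ : DecidableEquality Tm
Var m ≟tm Var n = map′ (λ { refl → refl }) (λ { refl → refl }) (m ≟ n)

_≟ty_ : DecidableEquality Ty
⋆ ≟ty ⋆ = yes refl
⋆ ≟ty ⇒ _ _ _ = no λ ()
⇒ _ _ _ ≟ty ⋆ = no λ ()
⇒ A t u ≟ty ⇒ B s v =
  map′ (λ { (refl , refl , refl) → refl }) (λ { refl → refl , refl , refl })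
       (A ≟ty B ×-dec t ≟tm s ×-dec u ≟tm v)

≡⊎∈⇔∈-snoc : {X : Set} {p q : X} {L : SnocList X} → (p ≡ q ⊎ p ∈ L) ⇔ p ∈ (L :: q)
≡⊎∈⇔∈-snoc = mk⇔ [ (λ { refl → here }) , there ]
                 (λ { here → inj₁ refl ; (there m) → inj₂ m })

∈-dec : {X : Set} → DecidableEquality X → (p : X) (L : SnocList X) → Dec (p ∈ L)
∈-dec _≟X_ p nil = no λ ()
∈-dec _≟X_ p (L :: q) = map ≡⊎∈⇔∈-snoc (p ≟X q ⊎-dec ∈-dec _≟X_ p L)

cc⇔ : ∀ {Γ x A} → (Γ ⊢ × Γ ⊢ty A × x ≡ length Γ) ⇔ (Γ :: (x , A)) ⊢
cc⇔ = mk⇔ (λ (Γ⊢ , A⊢ , x≡) → cc Γ⊢ A⊢ x≡) (λ { (cc Γ⊢ A⊢ x≡) → Γ⊢ , A⊢ , x≡ })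

ob⇔ : ∀ {Γ} → Γ ⊢ ⇔ Γ ⊢ty ⋆
ob⇔ = mk⇔ ob (λ { (ob Γ⊢) → Γ⊢ })

ar⇔ : ∀ {Γ A t u} → (Γ ⊢ t ∶ A × Γ ⊢ u ∶ A) ⇔ Γ ⊢ty ⇒ A t u
ar⇔ = mk⇔ (λ (t⊢ , u⊢) → ar t⊢ u⊢) (λ { (ar t⊢ u⊢) → t⊢ , u⊢ })

var⇔ : ∀ {Γ x A} → (Γ ⊢ × (x , A) ∈ Γ) ⇔ Γ ⊢ Var x ∶ A
var⇔ = mk⇔ (λ (Γ⊢ , x∈) → var Γ⊢ x∈) (λ { (var Γ⊢ x∈) → Γ⊢ , x∈ })

es⇔ : ∀ {Δ} → Δ ⊢ ⇔ Δ ⊢s nil ∶ nil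
es⇔ = mk⇔ es (λ { (es Δ⊢) → Δ⊢ })

sc⇔ : ∀ {Δ Γ γ x y A t} →
  (Δ ⊢s γ ∶ Γ × (Γ :: (x , A)) ⊢ × Δ ⊢ t ∶ (A [ γ ]ty) × x ≡ y)
    ⇔ Δ ⊢s (γ :: (y , t)) ∶ (Γ :: (x , A))
sc⇔ = mk⇔ (λ (γ⊢ , ΓA⊢ , t⊢ , x≡y) → sc γ⊢ ΓA⊢ t⊢ x≡y)
          (λ { (sc γ⊢ ΓA⊢ t⊢ x≡y) → γ⊢ , ΓA⊢ , t⊢ , x≡y })

⊢-dec : (Γ : Ctx) → Dec (Γ ⊢)
⊢ty-dec : (Γ : Ctx) (A : Ty) → Dec (Γ ⊢ty A)
⊢tm-dec : (Γ : Ctx) (A : Ty) (t : Tm) → Dec (Γ ⊢ t ∶ A)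

⊢-dec nil = yes ec
⊢-dec (Γ :: (x , A)) = map cc⇔ (⊢-dec Γ ×-dec ⊢ty-dec Γ A ×-dec x ≟ length Γ)

⊢ty-dec Γ ⋆ = map ob⇔ (⊢-dec Γ)
⊢ty-dec Γ (⇒ A t u) = map ar⇔ (⊢tm-dec Γ A t ×-dec ⊢tm-dec Γ A u)

⊢tm-dec Γ A (Var x) = map var⇔ (⊢-dec Γ ×-dec ∈-dec (≡-dec _≟_ _≟ty_) (x , A) Γ)

⊢s-dec : (Δ : Ctx) (γ : Sub) (Γ : Ctx) → Dec (Δ ⊢s γ ∶ Γ)
⊢s-dec Δ nil nil = map es⇔ (⊢-dec Δ)
⊢s-dec Δ nil (Γ :: _) = no λ ()
⊢s-dec Δ (γ :: _) nil = no λ ()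
⊢s-dec Δ (γ :: (y , t)) (Γ :: (x , A)) =
  map sc⇔ (⊢s-dec Δ γ Γ ×-dec ⊢-dec (Γ :: (x , A))
                ×-dec ⊢tm-dec Δ (A [ γ ]ty) t ×-dec x ≟ y)

mainTheorem6 : ((Γ : Ctx) → (Γ ⊢) ⊎ ¬ (Γ ⊢))
    × ((Δ : Ctx) (γ : Sub) (Γ : Ctx) → (Δ ⊢s γ ∶ Γ) ⊎ ¬ (Δ ⊢s γ ∶ Γ))
    × ((Γ : Ctx) (A : Ty) → (Γ ⊢ty A) ⊎ ¬ (Γ ⊢ty A))
    × ((Γ : Ctx) (A : Ty) (t : Tm) → (Γ ⊢ t ∶ A) ⊎ ¬ (Γ ⊢ t ∶ A))
mainTheorem6 =
    (λ Γ → toSum (⊢-dec Γ))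
  , (λ Δ γ Γ → toSum (⊢s-dec Δ γ Γ))
  , (λ Γ A → toSum (⊢ty-dec Γ A))
  , (λ Γ A t → toSum (⊢tm-dec Γ A t))
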